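{- Let $n=p_1^{m_1}\cdots p_\omega^{m_\omega}$ be a positive integer with distinct primes $p_i$ and exponents $m_i\ge1$ (for $n=1$, $\omega=0$). Let $\Delta(G^H(n))=\max_{v\in V(n)}(\Delta^-(v)+\Delta^+(v))$, where $\Delta^-(v),\Delta^+(v)$ are the in- and out-degrees of $v$ in the Hasse diagram $G^H(n)$. Then $\Delta(G^H(n))=\omega(n)+|\{i: m_i>1\}|$.
   Context: $V(n)$ is the set of positive divisors of $n$; $\omega(n)$ is the number of distinct prime factors of $n$. The Hasse diagram $G^H(n)$ is the directed graph on $V(n)$ whose arcs are the pairs $(a,b)$ with $a,b\in V(n)$, $a<b$, $a\mid b$, such that there is no $c\in V(n)$ with $a<c<b$, $a\mid c$, $c\mid b$. -}

module Defs where

open import Data.Nat using (ℕ; suc; _<_; _<?_; _⊔_; _+_; _^_)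
open import Data.Nat.Divisibility using (_∣_; _∣?_)
open import Data.Nat.Primality using (Prime; prime?)
open import Data.List using (List; filter; map; foldr; length; applyUpTo)
open import Data.List.Relation.Unary.All using (All; all?)
open import Data.Product using (_×_)
open import Relation.Nullary using (¬_; Dec)
open import Relation.Nullary.Decidable using (_×-dec_; ¬?)

oneTo : ℕ → List ℕ
oneTo n = applyUpTo suc n

V : ℕ → List ℕ
V n = filter (λ d → d ∣? n) (oneTo n)

Between : ℕ → ℕ → ℕ → Set
Between a b c = a < c × c < b × a ∣ c × c ∣ b

between? : ∀ a b c → Dec (Between a b c)
between? a b c = (a <? c) ×-dec ((c <? b) ×-dec ((a ∣? c) ×-dec (c ∣? b)))

Arc : ℕ → ℕ → ℕ → Set
Arc n a b = a < b × a ∣ b × All (λ c → ¬ Between a b c) (V n)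

arc? : ∀ n a b → Dec (Arc n a b)
arc? n a b = (a <? b) ×-dec ((a ∣? b) ×-dec all? (λ c → ¬? (between? a b c)) (V n))

inDeg : ℕ → ℕ → ℕ
inDeg n v = length (filter (λ a → arc? n a v) (V n))

outDeg : ℕ → ℕ → ℕ
outDeg n v = length (filter (λ b → arc? n v b) (V n))

maxDeg : ℕ → ℕ
maxDeg n = foldr _⊔_ 0 (map (λ v → inDeg n v + outDeg n v) (V n))

ω : ℕ → ℕ
ω n = length (filter (λ p → prime? p ×-dec (p ∣? n)) (oneTo n))

-- |{ i : m_i > 1 }|: number of primes p with p^2 ∣ n
-- (p_i has exponent m_i > 1 iff p_i² ∣ n).
bigExps : ℕ → ℕ
bigExps n = length (filter (λ p → prime? p ×-dec ((p ^ 2) ∣? n)) (oneTo n))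

module Submission where

-- An arc a → b of G^H(n) is exactly a step b = a · p by a prime p
-- (a composite step would leave room for an intermediate divisor).  Hence
--   Δ⁻(v) = #{ primes p : p ∣ v }       and   Δ⁺(v) = #{ primes p : v·p ∣ n }.
-- Every prime counted in either set divides n, and a prime counted in both
-- satisfies p² ∣ v·p ∣ n; so Δ⁻(v) + Δ⁺(v) ≤ ω(n) + #{ p : p² ∣ n } for
-- every divisor v.  Equality is attained at the radical d = p₁ ⋯ p_ω of n:
-- its prime divisors are those of n, and d·p ∣ n iff p ∣ n/d iff p² ∣ n.

open import Data.Nat
open import Data.Nat.Properties
open import Data.Nat.Divisibility
open import Data.Nat.Primality
open import Data.Nat.Primality.Factorisation using (factorise)
open import Data.Nat.ListAction using (product)
open import Data.List using (List; []; _∷_; filter; length; map; foldr)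
open import Data.List.Membership.Propositional using (_∈_)
open import Data.List.Membership.Propositional.Properties
  using (∈-applyUpTo⁺; ∈-applyUpTo⁻; ∈-filter⁺; ∈-filter⁻)
open import Data.List.Properties using (filter-≐)
open import Data.List.Relation.Unary.Any using (here; there)
open import Data.List.Relation.Unary.All as All using (All; []; _∷_)
open import Data.List.Relation.Unary.AllPairs using (_∷_)
open import Data.List.Relation.Unary.Unique.Propositional using (Unique)
import Data.List.Relation.Unary.Unique.Propositional.Properties as UniqueProps
open import Data.Product using (_×_; _,_; ∃-syntax; proj₁; proj₂)
open import Data.Sum using (inj₁; inj₂; [_,_]′)
open import Data.Empty using (⊥-elim)
open import Relation.Nullary using (¬_; Dec; yes; no; contradiction)
open import Relation.Nullary.Decidable using (_×-dec_)
open import Relation.Unary using (Decidable)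
open import Relation.Binary.PropositionalEquality
import Algebra.Properties.CommutativeSemigroup as CommSemigroupProperties
open CommSemigroupProperties +-commutativeSemigroup using (interchange)
open CommSemigroupProperties *-commutativeSemigroup using (x∙yz≈y∙xz)

open import Defs

variable
  A B : Set

delete : ∀ {y : A} {ys} → y ∈ ys →
         ∃[ ys′ ] (length ys ≡ suc (length ys′) × (∀ {z} → z ∈ ys → z ≢ y → z ∈ ys′))
delete {ys = _ ∷ ys} (here refl) =
  ys , refl , λ { (here refl) z≢y → contradiction refl z≢y ; (there z∈) _ → z∈ }
delete {ys = w ∷ ys} (there y∈) with delete y∈
... | ys′ , len , keep =
  w ∷ ys′ , cong suc len , λ { (here refl) _ → here refl ; (there z∈) z≢y → there (keep z∈ z≢y) }

length-≤-by-injection : (R : A → B → Set) → (∀ {x x′ y} → R x y → R x′ y → x ≡ x′) →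
                        (xs : List A) (ys : List B) → Unique xs →
                        (∀ {x} → x ∈ xs → ∃[ y ] (y ∈ ys × R x y)) → length xs ≤ length ys
length-≤-by-injection R inj [] ys _ _ = z≤n
length-≤-by-injection R inj (x ∷ xs) ys (x∉xs ∷ unique) image
  with image (here refl)
... | y , y∈ys , Rxy with delete y∈ys
... | ys′ , len , keep =
  subst (suc (length xs) ≤_) (sym len) (s≤s (length-≤-by-injection R inj xs ys′ unique image′))
  where
  image′ : ∀ {z} → z ∈ xs → ∃[ y′ ] (y′ ∈ ys′ × R z y′)
  image′ z∈xs with image (there z∈xs)
  ... | y′ , y′∈ys , Rzy′ =
    y′ , keep y′∈ys (λ { refl → All.lookup x∉xs z∈xs (inj Rxy Rzy′) }) , Rzy′

length-≡-by-correspondence :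
  (R : A → B → Set) → (∀ {x x′ y} → R x y → R x′ y → x ≡ x′) →
  (∀ {x y y′} → R x y → R x y′ → y ≡ y′) →
  (xs : List A) (ys : List B) → Unique xs → Unique ys →
  (∀ {x} → x ∈ xs → ∃[ y ] (y ∈ ys × R x y)) →
  (∀ {y} → y ∈ ys → ∃[ x ] (x ∈ xs × R x y)) → length xs ≡ length ys
length-≡-by-correspondence R injˡ injʳ xs ys uxs uys to from =
  ≤-antisym (length-≤-by-injection R injˡ xs ys uxs to)
            (length-≤-by-injection (λ y x → R x y) injʳ ys xs uys from)

indicator : ∀ {P : Set} → Dec P → ℕ
indicator (yes _) = 1
indicator (no _)  = 0

indicator-yes : ∀ {P : Set} → P → (d : Dec P) → 1 ≤ indicator d
indicator-yes _ (yes _) = ≤-refl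
indicator-yes p (no ¬p) = contradiction p ¬p

count : {P : A → Set} → Decidable P → List A → ℕ
count P? xs = length (filter P? xs)

count-∷ : {P : A → Set} (P? : Decidable P) (x : A) (xs : List A) →
          count P? (x ∷ xs) ≡ indicator (P? x) + count P? xs
count-∷ P? x xs with P? x
... | yes _ = refl
... | no _  = refl

module _ {P Q R S : A → Set} (P? : Decidable P) (Q? : Decidable Q)
         (R? : Decidable R) (S? : Decidable S)
         (P⇒R : ∀ {x} → P x → R x) (Q⇒R : ∀ {x} → Q x → R x)
         (P∧Q⇒S : ∀ {x} → P x → Q x → S x) where

  indicator-+-≤ : ∀ x → indicator (P? x) + indicator (Q? x) ≤ indicator (R? x) + indicator (S? x)
  indicator-+-≤ x with P? x | Q? x
  ... | yes p | yes q = +-mono-≤ (indicator-yes (P⇒R p) (R? x)) (indicator-yes (P∧Q⇒S p q) (S? x))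
  ... | yes p | no _  = ≤-trans (indicator-yes (P⇒R p) (R? x)) (m≤m+n _ _)
  ... | no _  | yes q = ≤-trans (indicator-yes (Q⇒R q) (R? x)) (m≤m+n _ _)
  ... | no _  | no _  = z≤n

  count-+-≤ : ∀ xs → count P? xs + count Q? xs ≤ count R? xs + count S? xs
  count-+-≤ [] = z≤n
  count-+-≤ (x ∷ xs) = begin
    count P? (x ∷ xs) + count Q? (x ∷ xs)
      ≡⟨ cong₂ _+_ (count-∷ P? x xs) (count-∷ Q? x xs) ⟩
    (indicator (P? x) + count P? xs) + (indicator (Q? x) + count Q? xs)
      ≡⟨ interchange (indicator (P? x)) (count P? xs) (indicator (Q? x)) (count Q? xs) ⟩
    (indicator (P? x) + indicator (Q? x)) + (count P? xs + count Q? xs)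
      ≤⟨ +-mono-≤ (indicator-+-≤ x) (count-+-≤ xs) ⟩
    (indicator (R? x) + indicator (S? x)) + (count R? xs + count S? xs)
      ≡⟨ interchange (indicator (R? x)) (indicator (S? x)) (count R? xs) (count S? xs) ⟩
    (indicator (R? x) + count R? xs) + (indicator (S? x) + count S? xs)
      ≡⟨ sym (cong₂ _+_ (count-∷ R? x xs) (count-∷ S? x xs)) ⟩
    count R? (x ∷ xs) + count S? (x ∷ xs) ∎
    where open ≤-Reasoning

maximum-attained : (f : A → ℕ) (M : ℕ) (xs : List A) → (∀ {x} → x ∈ xs → f x ≤ M) →
                   ∃[ x ] (x ∈ xs × f x ≡ M) → foldr _⊔_ 0 (map f xs) ≡ M
maximum-attained f M xs bound (x , x∈xs , fx≡M) = ≤-antisym (maximum≤ xs bound) (≤maximum xs x∈xs)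
  where
  maximum≤ : ∀ ys → (∀ {y} → y ∈ ys → f y ≤ M) → foldr _⊔_ 0 (map f ys) ≤ M
  maximum≤ [] _ = z≤n
  maximum≤ (y ∷ ys) bound = ⊔-lub (bound (here refl)) (maximum≤ ys (λ y∈ → bound (there y∈)))
  ≤maximum : ∀ ys → x ∈ ys → M ≤ foldr _⊔_ 0 (map f ys)
  ≤maximum (y ∷ ys) (here refl) = subst (_≤ foldr _⊔_ 0 (map f (y ∷ ys))) fx≡M (m≤m⊔n (f y) _)
  ≤maximum (y ∷ ys) (there x∈ys) = ≤-trans (≤maximum ys x∈ys) (m≤n⊔m (f y) _)

oneTo⁻ : ∀ {x n} → x ∈ oneTo n → 1 ≤ x × x ≤ n
oneTo⁻ x∈ with ∈-applyUpTo⁻ suc x∈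
... | _ , i<n , refl = s≤s z≤n , i<n

oneTo⁺ : ∀ {x n} → 1 ≤ x → x ≤ n → x ∈ oneTo n
oneTo⁺ {suc x} _ x≤n = ∈-applyUpTo⁺ suc x≤n

oneTo-unique : ∀ n → Unique (oneTo n)
oneTo-unique n = UniqueProps.applyUpTo⁺₁ suc n (λ i<j _ → <⇒≢ (s≤s i<j))

V⁻ : ∀ {x n} → x ∈ V n → 1 ≤ x × x ∣ n
V⁻ {x} {n} x∈ with ∈-filter⁻ (_∣? n) {xs = oneTo n} x∈
... | x∈oneTo , x∣n = proj₁ (oneTo⁻ x∈oneTo) , x∣n

V⁺ : ∀ {x n} → .{{NonZero n}} → 1 ≤ x → x ∣ n → x ∈ V n
V⁺ {n = n} 1≤x x∣n = ∈-filter⁺ (_∣? n) (oneTo⁺ 1≤x (∣⇒≤ x∣n)) x∣n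

V-unique : ∀ n → Unique (V n)
V-unique n = UniqueProps.filter⁺ (_∣? n) (oneTo-unique n)

positive-factorˡ : ∀ {v} a b → 1 ≤ v → v ≡ a * b → 1 ≤ a
positive-factorˡ zero    _ (s≤s z≤n) ()
positive-factorˡ (suc _) _ _ _ = s≤s z≤n

positive-factorʳ : ∀ {v} a b → 1 ≤ v → v ≡ a * b → 1 ≤ b
positive-factorʳ a b 1≤v v≡ab = positive-factorˡ b a 1≤v (trans v≡ab (*-comm a b))

prime≥1 : ∀ {p} → Prime p → 1 ≤ p
prime≥1 {p} pp = >-nonZero⁻¹ p {{prime⇒nonZero pp}}

-- Multiplying by a prime leaves no room for an intermediate divisor:
-- a ∣ c ∣ a · p forces c = a · 1 or c = a · p.
nothing-between-prime-step : ∀ {a p c} → 1 ≤ a → Prime p → ¬ Between a (a * p) c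
nothing-between-prime-step {a@(suc _)} {p} {c} _ pp (a<c , c<ap , divides r c≡ra , divides s ap≡sc)
  with prime⇒irreducible pp (divides s p≡sr)
  where
  instance _ = prime⇒nonZero pp
  p≡sr : p ≡ s * r
  p≡sr = *-cancelˡ-≡ p (s * r) a (begin
    a * p        ≡⟨ ap≡sc ⟩
    s * c        ≡⟨ cong (s *_) c≡ra ⟩
    s * (r * a)  ≡⟨ sym (*-assoc s r a) ⟩
    s * r * a    ≡⟨ *-comm (s * r) a ⟩
    a * (s * r)  ∎)
    where open ≡-Reasoning
... | inj₁ refl = <-irrefl (sym (trans c≡ra (*-identityˡ a))) a<c
... | inj₂ refl = <-irrefl (trans c≡ra (*-comm r a)) c<ap

prime-step⇒arc : ∀ {n a b p} → 1 ≤ a → Prime p → b ≡ a * p → Arc n a b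
prime-step⇒arc {a = a@(suc _)} {p = p} 1≤a pp refl =
  m<m*n a p (nonTrivial⇒n>1 p {{prime⇒nonTrivial pp}}) , divides p (*-comm a p) ,
  All.tabulate (λ _ → nothing-between-prime-step 1≤a pp)

-- Conversely, if b = q · a with q composite, q = t · r, then r · a is a
-- divisor of n strictly between a and b; so the quotient of an arc is prime.
arc⇒prime-step : ∀ {n a b} → .{{NonZero n}} → 1 ≤ a → b ∣ n → Arc n a b → ∃[ p ] (Prime p × b ≡ a * p)
arc⇒prime-step {n} {a@(suc _)} {b} 1≤a b∣n (a<b , divides q b≡qa , nothing-between) = quotient-prime q b≡qa
  where
  quotient-prime : ∀ q → b ≡ q * a → ∃[ p ] (Prime p × b ≡ a * p)
  quotient-prime 0 refl = ⊥-elim (<⇒≱ a<b z≤n)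
  quotient-prime 1 refl = ⊥-elim (<-irrefl (sym (*-identityˡ a)) a<b)
  quotient-prime q@(suc (suc _)) b≡qa with prime? q
  ... | yes pq = q , pq , trans b≡qa (*-comm q a)
  ... | no ¬pq with ¬prime⇒composite ¬pq
  ... | hasNonTrivialDivisor {r} {{nt}} r<q (divides t q≡tr) =
        ⊥-elim (All.lookup nothing-between ra∈V (a<ra , ra<b , divides r refl , divides t b≡t[ra]))
    where
    a<ra : a < r * a
    a<ra = subst (a <_) (*-comm a r) (m<m*n a r (nonTrivial⇒n>1 r {{nt}}))
    ra<b : r * a < b
    ra<b = subst (r * a <_) (sym b≡qa) (*-monoˡ-< a r<q)
    b≡t[ra] : b ≡ t * (r * a)
    b≡t[ra] = trans b≡qa (trans (cong (_* a) q≡tr) (*-assoc t r a))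
    ra∈V : r * a ∈ V n
    ra∈V = V⁺ (≤-trans 1≤a (<⇒≤ a<ra)) (∣-trans (divides t b≡t[ra]) b∣n)

-- #primes n P? : the number of primes p ≤ n satisfying P.  Every prime
-- divisor of a divisor of n is ≤ n, so this range is never a restriction.
#primes : ∀ {P : ℕ → Set} → ℕ → Decidable P → ℕ
#primes n P? = count (λ p → prime? p ×-dec P? p) (oneTo n)

cofactor-uniqueˡ : ∀ {v a a′ b} → 1 ≤ v → v ≡ a * b → v ≡ a′ * b → a ≡ a′
cofactor-uniqueˡ {a = a} {a′} {b} 1≤v v≡ab v≡a′b =
  *-cancelʳ-≡ a a′ b {{>-nonZero (positive-factorʳ a b 1≤v v≡ab)}} (trans (sym v≡ab) v≡a′b)

cofactor-uniqueʳ : ∀ {v a b b′} → 1 ≤ v → v ≡ a * b → v ≡ a * b′ → b ≡ b′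
cofactor-uniqueʳ {a = a} {b} {b′} 1≤v v≡ab v≡ab′ =
  *-cancelˡ-≡ b b′ a {{>-nonZero (positive-factorˡ a b 1≤v v≡ab)}} (trans (sym v≡ab) v≡ab′)

-- Δ⁻(v) is the number of primes dividing v: an arc a → v corresponds to
-- the prime p with v = a · p.
inDeg≡ : ∀ {n v} → .{{NonZero n}} → v ∈ V n → inDeg n v ≡ #primes n (_∣? v)
inDeg≡ {n} {v} v∈V =
  length-≡-by-correspondence (λ a p → v ≡ a * p)
    (λ {a} {a′} {p} → cofactor-uniqueˡ {a = a} {a′} {p} 1≤v)
    (λ {a} {p} {p′} → cofactor-uniqueʳ {a = a} {p} {p′} 1≤v)
    predecessors primes (UniqueProps.filter⁺ _ (V-unique n)) (UniqueProps.filter⁺ _ (oneTo-unique n))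
    predecessor⇒prime prime⇒predecessor
  where
  1≤v = proj₁ (V⁻ {n = n} v∈V)
  v∣n = proj₂ (V⁻ {n = n} v∈V)
  predecessors = filter (λ a → arc? n a v) (V n)
  primes = filter (λ p → prime? p ×-dec (p ∣? v)) (oneTo n)

  predecessor⇒prime : ∀ {a} → a ∈ predecessors → ∃[ p ] (p ∈ primes × v ≡ a * p)
  predecessor⇒prime {a} a∈ with ∈-filter⁻ (λ a → arc? n a v) {xs = V n} a∈
  ... | a∈V , arc with arc⇒prime-step (proj₁ (V⁻ {n = n} a∈V)) v∣n arc
  ... | p , pp , v≡ap =
    p , ∈-filter⁺ _ (oneTo⁺ (prime≥1 pp) (∣⇒≤ (∣-trans p∣v v∣n))) (pp , p∣v) , v≡ap
    where p∣v = divides a v≡ap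

  prime⇒predecessor : ∀ {p} → p ∈ primes → ∃[ a ] (a ∈ predecessors × v ≡ a * p)
  prime⇒predecessor {p} p∈ with ∈-filter⁻ (λ p → prime? p ×-dec (p ∣? v)) {xs = oneTo n} p∈
  ... | _ , pp , divides a v≡ap =
    a , ∈-filter⁺ _ (V⁺ {n = n} 1≤a (∣-trans (divides p (trans v≡ap (*-comm a p))) v∣n))
                    (prime-step⇒arc {n = n} 1≤a pp v≡ap) ,
    v≡ap
    where 1≤a = positive-factorˡ a p 1≤v v≡ap

-- Δ⁺(v) is the number of primes p with v · p ∣ n: an arc v → b
-- corresponds to the prime p with b = v · p.
outDeg≡ : ∀ {n v} → .{{NonZero n}} → v ∈ V n → outDeg n v ≡ #primes n (λ p → (v * p) ∣? n)
outDeg≡ {n} {v} v∈V =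
  length-≡-by-correspondence (λ b p → b ≡ v * p) (λ b≡vp b′≡vp → trans b≡vp (sym b′≡vp))
    (λ {_} {p} {p′} b≡vp b≡vp′ → *-cancelˡ-≡ p p′ v {{>-nonZero 1≤v}} (trans (sym b≡vp) b≡vp′))
    successors primes (UniqueProps.filter⁺ _ (V-unique n)) (UniqueProps.filter⁺ _ (oneTo-unique n))
    successor⇒prime prime⇒successor
  where
  1≤v = proj₁ (V⁻ {n = n} v∈V)
  successors = filter (λ b → arc? n v b) (V n)
  primes = filter (λ p → prime? p ×-dec ((v * p) ∣? n)) (oneTo n)

  successor⇒prime : ∀ {b} → b ∈ successors → ∃[ p ] (p ∈ primes × b ≡ v * p)
  successor⇒prime b∈ with ∈-filter⁻ (λ b → arc? n v b) {xs = V n} b∈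
  ... | b∈V , arc with arc⇒prime-step 1≤v (proj₂ (V⁻ {n = n} b∈V)) arc
  ... | p , pp , b≡vp =
    p , ∈-filter⁺ _ (oneTo⁺ (prime≥1 pp) (∣⇒≤ (∣-trans (divides v b≡vp) b∣n))) (pp , subst (_∣ n) b≡vp b∣n) ,
    b≡vp
    where b∣n = proj₂ (V⁻ {n = n} b∈V)

  prime⇒successor : ∀ {p} → p ∈ primes → ∃[ b ] (b ∈ successors × b ≡ v * p)
  prime⇒successor {p} p∈ with ∈-filter⁻ (λ p → prime? p ×-dec ((v * p) ∣? n)) {xs = oneTo n} p∈
  ... | _ , pp , vp∣n =
    v * p , ∈-filter⁺ _ (V⁺ {n = n} (*-mono-≤ 1≤v (prime≥1 pp)) vp∣n) (prime-step⇒arc {n = n} 1≤v pp refl) , refl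

square : ∀ p → p * p ≡ p ^ 2
square p = cong (p *_) (sym (*-identityʳ p))

-- For every divisor v of n: a prime dividing v, or with v · p ∣ n, divides
-- n; a prime doing both satisfies p² ∣ v · p ∣ n.  Hence
-- Δ⁻(v) + Δ⁺(v) ≤ ω(n) + #{ p : p² ∣ n }.
degree-bound : ∀ {n v} → v ∣ n → #primes n (_∣? v) + #primes n (λ p → (v * p) ∣? n) ≤ ω n + bigExps n
degree-bound {n} {v} v∣n =
  count-+-≤ (λ p → prime? p ×-dec (p ∣? v)) (λ p → prime? p ×-dec ((v * p) ∣? n))
            (λ p → prime? p ×-dec (p ∣? n)) (λ p → prime? p ×-dec ((p ^ 2) ∣? n))
            (λ (pp , p∣v) → pp , ∣-trans p∣v v∣n)
            (λ (pp , vp∣n) → pp , ∣-trans (n∣m*n v) vp∣n)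
            (λ { {p} (pp , p∣v) (_ , vp∣n) → pp , subst (_∣ n) (square p) (∣-trans (*-monoˡ-∣ p p∣v) vp∣n) })
            (oneTo n)

-- m = d · e where d is the radical of m (it has the prime divisors of m)
-- and the prime divisors of e are the primes whose square divides m.
-- The remaining direction q ∣ d ⇒ q ∣ m holds because d ∣ m.
record RadicalSplit (m d e : ℕ) : Set where
  field
    m≡d*e     : m ≡ d * e
    radical   : ∀ {q} → Prime q → q ∣ m → q ∣ d
    cofactor⁺ : ∀ {q} → Prime q → q ∣ e → q * q ∣ m
    cofactor⁻ : ∀ {q} → Prime q → q * q ∣ m → q ∣ e

open RadicalSplit

prime-square-cancel : ∀ {q p m} → Prime q → ¬ q ∣ p → q * q ∣ p * m → q * q ∣ m
prime-square-cancel {q} {p} {m} pq q∤p qq∣pm with euclidsLemma p m pq (∣-trans (m∣m*n q) qq∣pm)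
... | inj₁ q∣p = contradiction q∣p q∤p
... | inj₂ (divides k refl) with euclidsLemma p k pq qk∣pk
  where
  qk∣pk : q ∣ p * k
  qk∣pk = *-cancelʳ-∣ q {{prime⇒nonZero pq}} (subst (q * q ∣_) (sym (*-assoc p k q)) qq∣pm)
... | inj₁ q∣p = contradiction q∣p q∤p
... | inj₂ q∣k = *-monoˡ-∣ q q∣k

prime∣prime⇒≡ : ∀ {q p} → Prime q → Prime p → q ∣ p → q ≡ p
prime∣prime⇒≡ pq pp q∣p with prime⇒irreducible pp q∣p
... | inj₁ refl = contradiction pq ¬prime[1]
... | inj₂ q≡p  = q≡p

radical-split-one : RadicalSplit 1 1 1
radical-split-one = record
  { m≡d*e     = refl
  ; radical   = λ _ q∣1 → q∣1
  ; cofactor⁺ = λ pq q∣1 → contradiction (subst Prime (∣1⇒≡1 q∣1) pq) ¬prime[1]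
  ; cofactor⁻ = λ {q} _ qq∣1 → ∣-trans (m∣m*n q) qq∣1
  }

radical-split-new : ∀ {p m d e} → Prime p → ¬ p ∣ m → RadicalSplit m d e → RadicalSplit (p * m) (p * d) e
radical-split-new {p} {m} {d} {e} pp p∤m s = record
  { m≡d*e     = trans (cong (p *_) (m≡d*e s)) (sym (*-assoc p d e))
  ; radical   = λ pq q∣pm → [ ∣m⇒∣m*n d , (λ q∣m → ∣n⇒∣m*n p (radical s pq q∣m)) ]′ (euclidsLemma p m pq q∣pm)
  ; cofactor⁺ = λ pq q∣e → ∣n⇒∣m*n p (cofactor⁺ s pq q∣e)
  ; cofactor⁻ = λ pq qq∣pm → cofactor⁻ s pq (square-divides-m pq qq∣pm)
  }
  where
  -- q² ∣ p · m gives q² ∣ m, since q = p would force p ∣ m.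
  square-divides-m : ∀ {q} → Prime q → q * q ∣ p * m → q * q ∣ m
  square-divides-m {q} pq qq∣pm with q ∣? p
  ... | no q∤p = prime-square-cancel pq q∤p qq∣pm
  ... | yes q∣p with prime∣prime⇒≡ pq pp q∣p
  ... | refl = contradiction (*-cancelˡ-∣ p {{prime⇒nonZero pp}} qq∣pm) p∤m

radical-split-repeated : ∀ {p m d e} → p ∣ m → RadicalSplit m d e → RadicalSplit (p * m) d (p * e)
radical-split-repeated {p} {m} {d} {e} p∣m s = record
  { m≡d*e     = trans (cong (p *_) (m≡d*e s)) (x∙yz≈y∙xz p d e)
  ; radical   = λ pq q∣pm → radical s pq ([ (λ q∣p → ∣-trans q∣p p∣m) , (λ q∣m → q∣m) ]′ (euclidsLemma p m pq q∣pm))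
  ; cofactor⁺ = λ pq q∣pe →
      [ (λ q∣p → *-pres-∣ q∣p (∣-trans q∣p p∣m)) , (λ q∣e → ∣n⇒∣m*n p (cofactor⁺ s pq q∣e)) ]′
      (euclidsLemma p e pq q∣pe)
  ; cofactor⁻ = cofactor⁻′
  }
  where
  cofactor⁻′ : ∀ {q} → Prime q → q * q ∣ p * m → q ∣ p * e
  cofactor⁻′ {q} pq qq∣pm with q ∣? p
  ... | yes q∣p = ∣m⇒∣m*n e q∣p
  ... | no q∤p  = ∣n⇒∣m*n p (cofactor⁻ s pq (prime-square-cancel pq q∤p qq∣pm))

radical-split-product : ∀ ps → All Prime ps → ∃[ d ] ∃[ e ] RadicalSplit (product ps) d e
radical-split-product [] [] = 1 , 1 , radical-split-one
radical-split-product (p ∷ ps) (pp ∷ all-prime) with radical-split-product ps all-prime | p ∣? product ps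
... | d , e , s | no p∤m  = p * d , e , radical-split-new pp p∤m s
... | d , e , s | yes p∣m = d , p * e , radical-split-repeated p∣m s

radical-split : ∀ n → .{{NonZero n}} → ∃[ d ] ∃[ e ] RadicalSplit n d e
radical-split n with factorise n
... | record { factors = ps ; isFactorisation = n≡Πps ; factorsPrime = all-prime } =
  subst (λ m → ∃[ d ] ∃[ e ] RadicalSplit m d e) (sym n≡Πps) (radical-split-product ps all-prime)

radical∣ : ∀ {m d e} → RadicalSplit m d e → d ∣ m
radical∣ {d = d} {e} s = divides e (trans (m≡d*e s) (*-comm d e))

radical-inCount : ∀ {n d e} → RadicalSplit n d e → #primes n (_∣? d) ≡ ω n
radical-inCount {n} {d} s =
  cong length (filter-≐ (λ p → prime? p ×-dec (p ∣? d)) (λ p → prime? p ×-dec (p ∣? n))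
                        ((λ (pp , p∣d) → pp , ∣-trans p∣d (radical∣ s)) ,
                         (λ (pp , p∣n) → pp , radical s pp p∣n))
                        (oneTo n))

-- ... and d · p ∣ n = d · e holds iff p ∣ e iff p² ∣ n.
radical-outCount : ∀ {n d e} → 1 ≤ d → RadicalSplit n d e → #primes n (λ p → (d * p) ∣? n) ≡ bigExps n
radical-outCount {n} {d} {e} 1≤d s =
  cong length (filter-≐ (λ p → prime? p ×-dec ((d * p) ∣? n)) (λ p → prime? p ×-dec ((p ^ 2) ∣? n))
                        (to , from) (oneTo n))
  where
  instance _ = >-nonZero 1≤d
  to : ∀ {p} → Prime p × d * p ∣ n → Prime p × p ^ 2 ∣ n
  to {p} (pp , dp∣n) =
    pp , subst (_∣ n) (square p) (cofactor⁺ s pp (*-cancelˡ-∣ d (subst (d * p ∣_) (m≡d*e s) dp∣n)))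
  from : ∀ {p} → Prime p × p ^ 2 ∣ n → Prime p × d * p ∣ n
  from {p} (pp , p²∣n) =
    pp , subst (d * p ∣_) (sym (m≡d*e s)) (*-monoʳ-∣ d (cofactor⁻ s pp (subst (_∣ n) (sym (square p)) p²∣n)))

theorem7 : (n : ℕ) → 1 ≤ n → maxDeg n ≡ ω n + bigExps n
theorem7 n@(suc _) 1≤n with radical-split n
... | d , e , s = maximum-attained degree (ω n + bigExps n) (V n) bounded (d , d∈V , attained)
  where
  degree : ℕ → ℕ
  degree v = inDeg n v + outDeg n v

  degree≡ : ∀ {v} → v ∈ V n → degree v ≡ #primes n (_∣? v) + #primes n (λ p → (v * p) ∣? n)
  degree≡ v∈V = cong₂ _+_ (inDeg≡ {n} v∈V) (outDeg≡ {n} v∈V)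

  bounded : ∀ {v} → v ∈ V n → degree v ≤ ω n + bigExps n
  bounded v∈V = subst (_≤ ω n + bigExps n) (sym (degree≡ v∈V)) (degree-bound {n} (proj₂ (V⁻ {n = n} v∈V)))

  1≤d : 1 ≤ d
  1≤d = positive-factorˡ d e 1≤n (m≡d*e s)

  d∈V : d ∈ V n
  d∈V = V⁺ {n = n} 1≤d (radical∣ s)

  attained : degree d ≡ ω n + bigExps n
  attained = trans (degree≡ d∈V) (cong₂ _+_ (radical-inCount s) (radical-outCount 1≤d s))
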